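{- Let $\mathcal{G}_3 = \operatorname{Av}(51423, 51432, 52413, 52431, 53412, 53421, 54312, 54321)$. Then $\sum_{n\ge 0}|\mathcal{G}_3\cap S_n|\,x^n = \dfrac{5 - 4x -\sqrt{1 - 8x + 8x^2}}{4 - 4x}$.
   Context: $S_n$ is the set of permutations of size $n$ (with $S_0$ containing the empty permutation). $\operatorname{Av}(B)$ denotes the set of permutations containing none of the patterns in $B$, where $\pi$ contains $\sigma$ of size $k$ if some subsequence $\pi(i_1)\cdots\pi(i_k)$, $i_1<\cdots<i_k$, is order-isomorphic to $\sigma$. The square root is the formal power series with constant term $1$. -}

module Defs where

open import Data.Nat as ℕ using (ℕ; zero; suc; _<ᵇ_; _∸_)
open import Data.Integer as ℤ using (ℤ; +_)
open import Data.Bool using (Bool; true; false; _∧_; not; if_then_else_)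
open import Data.List using (List; []; _∷_; length; map; concatMap; filter; upTo; zipWith; foldr)
open import Data.Bool.ListAction using (all; any)
open import Function using (_∘_)
open import Relation.Binary.PropositionalEquality using (_≡_)
open import Data.Bool using (T)
open import Relation.Nullary.Decidable using (Dec)
open import Data.Bool.Properties using (T?)

-- Permutations of size n, as lists (one-line notation) over {0,…,n-1}.

insertEverywhere : ℕ → List ℕ → List (List ℕ)
insertEverywhere x [] = (x ∷ []) ∷ []
insertEverywhere x (y ∷ ys) = (x ∷ y ∷ ys) ∷ map (y ∷_) (insertEverywhere x ys)

S : ℕ → List (List ℕ)
S zero = [] ∷ []
S (suc n) = concatMap (insertEverywhere n) (S n)

subseqs : ℕ → List ℕ → List (List ℕ)
subseqs zero _ = [] ∷ []
subseqs (suc k) [] = []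
subseqs (suc k) (x ∷ xs) = map (x ∷_) (subseqs k xs) ++' subseqs (suc k) xs
  where
  _++'_ : List (List ℕ) → List (List ℕ) → List (List ℕ)
  [] ++' ys = ys
  (a ∷ as) ++' ys = a ∷ (as ++' ys)

_==ᵇ_ : Bool → Bool → Bool
true ==ᵇ b = b
false ==ᵇ b = not b

orderIso : List ℕ → List ℕ → Bool
orderIso [] [] = true
orderIso [] (_ ∷ _) = false
orderIso (_ ∷ _) [] = false
orderIso (u ∷ us) (v ∷ vs) =
  all (λ b → b) (zipWith (λ u' v' → (u <ᵇ u') ==ᵇ (v <ᵇ v')) us vs) ∧ orderIso us vs

contains : List ℕ → List ℕ → Bool
contains π σ = any (orderIso σ) (subseqs (length σ) π)

avoids : List (List ℕ) → List ℕ → Bool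
avoids B π = all (λ σ → not (contains π σ)) B

G3basis : List (List ℕ)
G3basis =
  (5 ∷ 1 ∷ 4 ∷ 2 ∷ 3 ∷ []) ∷ (5 ∷ 1 ∷ 4 ∷ 3 ∷ 2 ∷ []) ∷
  (5 ∷ 2 ∷ 4 ∷ 1 ∷ 3 ∷ []) ∷ (5 ∷ 2 ∷ 4 ∷ 3 ∷ 1 ∷ []) ∷
  (5 ∷ 3 ∷ 4 ∷ 1 ∷ 2 ∷ []) ∷ (5 ∷ 3 ∷ 4 ∷ 2 ∷ 1 ∷ []) ∷
  (5 ∷ 4 ∷ 3 ∷ 1 ∷ 2 ∷ []) ∷ (5 ∷ 4 ∷ 3 ∷ 2 ∷ 1 ∷ []) ∷ []

countG3 : ℕ → ℕ
countG3 n = length (filter (λ π → T? (avoids G3basis π)) (S n))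

FPS : Set
FPS = ℕ → ℤ

_⋆_ : FPS → FPS → FPS
(f ⋆ g) n = foldr ℤ._+_ (+ 0) (map (λ i → f i ℤ.* g (n ∸ i)) (upTo (suc n)))

_⊖_ : FPS → FPS → FPS
(f ⊖ g) n = f n ℤ.- g n

-- polynomial from its coefficient list (constant term first)
poly : List ℤ → FPS
poly [] _ = + 0
poly (c ∷ cs) zero = c
poly (c ∷ cs) (suc n) = poly cs n

G3gf : FPS
G3gf n = + countG3 n

-- Call a fork an entry followed by two smaller ones. The eight basis patterns are the
-- words e a b c d with e largest and b c d a fork, so π avoids them iff for no entry x
-- do the smaller entries after x, with the first of them removed, contain a fork.
-- Build permutations by inserting the maximum n, and label π by the length ℓ of its
-- longest fork-free suffix. Inserting n with s entries after it keeps π in the class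
-- iff s ≤ ℓ + 1, and the child has label ℓ + 1 if s < 2 and min(ℓ, s) otherwise.
-- Counting descendants in this generating tree gives a(k+2) = a(k+1) + d(k) for
-- a(n) = |G₃ ∩ S_n|, where d(k) counts the depth-k descendants of label 2, together
-- with d(k+1) = 4 d(k) + 2 (d ∗ d)(k−1). Hence T = x + x² d satisfies 2T² = T − x + x²,
-- so R = 1 − 4T has R² = 1 − 8x + 8x², and (1 − x) A = 1 − x + T becomes
-- (4 − 4x) A = 5 − 4x − R.

module Submission where

open import Data.Bool using (Bool; true; false; _∧_; _∨_; not; if_then_else_; T)
open import Data.Bool.ListAction using (or; all; any)
open import Data.Bool.Properties
  using (∧-comm; ∧-assoc; ∨-assoc; ∨-zeroʳ; not-involutive; if-cong; if-cong-else; if-float; T-≡)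
open import Data.Empty using (⊥; ⊥-elim)
open import Data.Integer as ℤ using (ℤ; +_; -[1+_])
open import Data.Integer.Properties using (pos-+; pos-*; +-inverseʳ; +-identityˡ)
open import Data.Integer.Tactic.RingSolver using () renaming (solve-∀ to solveℤ-∀)
open import Data.List using (List; []; _∷_; _++_; map; foldr; length; filterᵇ; concatMap; applyUpTo)
open import Data.List.Properties
  using (map-∘; map-cong; map-cong-local; map-++; length-++; length-++-sucʳ; ++-assoc)
open import Data.List.Relation.Unary.All as All using (All; []; _∷_)
open import Data.List.Relation.Unary.All.Properties using (++⁻ʳ; map⁺; concat⁺)
open import Data.Nat using (ℕ; zero; suc; _+_; _*_; _∸_; _≤_; _<_; _<ᵇ_; _≟_; z≤n; s≤s)
open import Data.Nat.Induction using (<-rec)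
open import Data.Nat.ListAction using (sum)
open import Data.Nat.ListAction.Properties using (sum-++)
open import Data.Nat.Properties
  using ( <ᵇ⇒<; <⇒<ᵇ; ≮⇒≥; <-irrefl; ≤-refl; ≤-trans; <-≤-trans; <⇒≤; ≤-pred; ≤∧≢⇒<
        ; n≤1+n; m≤n+m; n<1+n; m<n⇒m<1+n; m∸n≤m; +-∸-assoc; n∸n≡0
        ; +-identityʳ; +-suc; +-assoc; *-zeroʳ; *-identityʳ; *-assoc; *-distribˡ-+; *-distribʳ-+ )
open import Data.Nat.Tactic.RingSolver using (solve-∀)
open import Data.Product using (Σ; _×_; _,_)
open import Function using (_∘_; id; Equivalence)
open import Relation.Binary.PropositionalEquality
open import Relation.Nullary using (yes; no)
open ≡-Reasoning

open import Defs

<ᵇ≡true⇒< : ∀ m n → (m <ᵇ n) ≡ true → m < n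
<ᵇ≡true⇒< m n = <ᵇ⇒< m n ∘ Equivalence.from T-≡

<ᵇ≡false⇒≥ : ∀ m n → (m <ᵇ n) ≡ false → n ≤ m
<ᵇ≡false⇒≥ m n eq = ≮⇒≥ (λ m<n → subst T eq (<⇒<ᵇ m<n))

<⇒<ᵇ≡true : ∀ {m n} → m < n → (m <ᵇ n) ≡ true
<⇒<ᵇ≡true = Equivalence.to T-≡ ∘ <⇒<ᵇ

≥⇒<ᵇ≡false : ∀ {m n} → n ≤ m → (m <ᵇ n) ≡ false
≥⇒<ᵇ≡false {m} {n} n≤m with m <ᵇ n in eq
... | true = ⊥-elim (<-irrefl refl (<-≤-trans (<ᵇ≡true⇒< m n eq) n≤m))
... | false = refl

_≥ᵇ_ : ℕ → ℕ → Bool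
x ≥ᵇ z = not (x <ᵇ z)

any-++ : ∀ {A : Set} (f : A → Bool) xs ys → any f (xs ++ ys) ≡ any f xs ∨ any f ys
any-++ f [] ys = refl
any-++ f (x ∷ xs) ys = trans (cong (f x ∨_) (any-++ f xs ys)) (sym (∨-assoc (f x) _ _))

any-map : ∀ {A B : Set} (f : B → Bool) (g : A → B) xs → any f (map g xs) ≡ any (f ∘ g) xs
any-map f g xs = cong or (sym (map-∘ xs))

any-∨ : ∀ {A : Set} (f g : A → Bool) xs → any (λ x → f x ∨ g x) xs ≡ any f xs ∨ any g xs
any-∨ f g [] = refl
any-∨ f g (x ∷ xs) =
  trans (cong ((f x ∨ g x) ∨_) (any-∨ f g xs)) (interchange (f x) (g x) (any f xs) (any g xs))
  where
  interchange : ∀ a b c d → (a ∨ b) ∨ (c ∨ d) ≡ (a ∨ c) ∨ (b ∨ d)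
  interchange true b c d = refl
  interchange false true c d = sym (∨-zeroʳ c)
  interchange false false c d = refl

any-false : ∀ {A : Set} (xs : List A) → any (λ _ → false) xs ≡ false
any-false [] = refl
any-false (x ∷ xs) = any-false xs

any-comm : ∀ {A B : Set} (f : A → B → Bool) xs ys →
           any (λ x → any (f x) ys) xs ≡ any (λ y → any (λ x → f x y) xs) ys
any-comm f [] ys = sym (any-false ys)
any-comm f (x ∷ xs) ys =
  trans (cong (any (f x) ys ∨_) (any-comm f xs ys)) (sym (any-∨ (f x) (λ y → any (λ x → f x y) xs) ys))

all-not : ∀ {A : Set} (f : A → Bool) xs → all (not ∘ f) xs ≡ not (any f xs)
all-not f [] = refl
all-not f (x ∷ xs) with f x
... | true = refl
... | false = all-not f xs

sum-map-concatMap : ∀ {A B : Set} (g : B → ℕ) (f : A → List B) xs →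
                    sum (map g (concatMap f xs)) ≡ sum (map (sum ∘ map g ∘ f) xs)
sum-map-concatMap g f [] = refl
sum-map-concatMap g f (x ∷ xs) = begin
  sum (map g (f x ++ concatMap f xs))
    ≡⟨ cong sum (map-++ g (f x) (concatMap f xs)) ⟩
  sum (map g (f x) ++ map g (concatMap f xs))
    ≡⟨ sum-++ (map g (f x)) (map g (concatMap f xs)) ⟩
  sum (map g (f x)) + sum (map g (concatMap f xs))
    ≡⟨ cong (_+_ (sum (map g (f x)))) (sum-map-concatMap g f xs) ⟩
  sum (map g (f x)) + sum (map (sum ∘ map g ∘ f) xs) ∎

length-filterᵇ : ∀ {A : Set} (p : A → Bool) xs →
                 length (filterᵇ p xs) ≡ sum (map (λ x → if p x then 1 else 0) xs)
length-filterᵇ p [] = refl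
length-filterᵇ p (x ∷ xs) with p x
... | true = cong suc (length-filterᵇ p xs)
... | false = length-filterᵇ p xs

-- The append used by `subseqs` is local to its where block; this meta is solved
-- to it by unification, which gives us a name to reason about it.
mutual
  subseqs-append : ℕ → ℕ → List ℕ → List (List ℕ) → List (List ℕ) → List (List ℕ)
  subseqs-append = _

  subseqs-suc-cons′ : ∀ k x xs → subseqs (suc k) (x ∷ xs)
                      ≡ subseqs-append k x xs (map (x ∷_) (subseqs k xs)) (subseqs (suc k) xs)
  subseqs-suc-cons′ k x xs with map {B = List ℕ} (x ∷_) (subseqs k xs) | subseqs (suc k) xs
  ... | A | B = refl

subseqs-append≡++ : ∀ k x xs A B → subseqs-append k x xs A B ≡ A ++ B
subseqs-append≡++ k x xs [] B = refl
subseqs-append≡++ k x xs (a ∷ A) B = cong (a ∷_) (subseqs-append≡++ k x xs A B)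

subseqs-suc-cons : ∀ k x xs → subseqs (suc k) (x ∷ xs) ≡ map (x ∷_) (subseqs k xs) ++ subseqs (suc k) xs
subseqs-suc-cons k x xs =
  trans (subseqs-suc-cons′ k x xs) (subseqs-append≡++ k x xs (map (x ∷_) (subseqs k xs)) (subseqs (suc k) xs))

anySubseq : ℕ → (List ℕ → Bool) → List ℕ → Bool
anySubseq k f π = any f (subseqs k π)

anySubseq-cons : ∀ k f x xs →
  anySubseq (suc k) f (x ∷ xs) ≡ anySubseq k (f ∘ (x ∷_)) xs ∨ anySubseq (suc k) f xs
anySubseq-cons k f x xs = begin
  any f (subseqs (suc k) (x ∷ xs))
    ≡⟨ cong (any f) (subseqs-suc-cons k x xs) ⟩
  any f (map (x ∷_) (subseqs k xs) ++ subseqs (suc k) xs)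
    ≡⟨ any-++ f (map (x ∷_) (subseqs k xs)) _ ⟩
  any f (map (x ∷_) (subseqs k xs)) ∨ anySubseq (suc k) f xs
    ≡⟨ cong (_∨ anySubseq (suc k) f xs) (any-map f (x ∷_) (subseqs k xs)) ⟩
  anySubseq k (f ∘ (x ∷_)) xs ∨ anySubseq (suc k) f xs ∎

anySubseq-cong : ∀ k {f g : List ℕ → Bool} → (∀ w → length w ≡ k → f w ≡ g w) →
                 ∀ π → anySubseq k f π ≡ anySubseq k g π
anySubseq-cong zero f≗g π = cong (_∨ false) (f≗g [] refl)
anySubseq-cong (suc k) f≗g [] = refl
anySubseq-cong (suc k) {f} {g} f≗g (x ∷ xs) = begin
  anySubseq (suc k) f (x ∷ xs)
    ≡⟨ anySubseq-cons k f x xs ⟩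
  anySubseq k (f ∘ (x ∷_)) xs ∨ anySubseq (suc k) f xs
    ≡⟨ cong₂ _∨_ (anySubseq-cong k (λ w e → f≗g (x ∷ w) (cong suc e)) xs)
                 (anySubseq-cong (suc k) f≗g xs) ⟩
  anySubseq k (g ∘ (x ∷_)) xs ∨ anySubseq (suc k) g xs
    ≡⟨ anySubseq-cons k g x xs ⟨
  anySubseq (suc k) g (x ∷ xs) ∎

anySubseq-false : ∀ k π → anySubseq k (λ _ → false) π ≡ false
anySubseq-false zero π = refl
anySubseq-false (suc k) [] = refl
anySubseq-false (suc k) (x ∷ xs) =
  trans (anySubseq-cons k _ x xs) (cong₂ _∨_ (anySubseq-false k xs) (anySubseq-false (suc k) xs))

anySubseq-filter : ∀ k (p : ℕ → Bool) (g : List ℕ → Bool) xs →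
                   anySubseq k (λ v → all p v ∧ g v) xs ≡ anySubseq k g (filterᵇ p xs)
anySubseq-filter zero p g xs = refl
anySubseq-filter (suc k) p g [] = refl
anySubseq-filter (suc k) p g (x ∷ xs) with p x in px
... | true = begin
  anySubseq (suc k) (λ v → all p v ∧ g v) (x ∷ xs)
    ≡⟨ anySubseq-cons k _ x xs ⟩
  anySubseq k (λ v → (p x ∧ all p v) ∧ g (x ∷ v)) xs ∨ anySubseq (suc k) (λ v → all p v ∧ g v) xs
    ≡⟨ cong₂ _∨_ (anySubseq-cong k (λ v _ → cong (λ b → (b ∧ all p v) ∧ g (x ∷ v)) px) xs)
                 (anySubseq-filter (suc k) p g xs) ⟩
  anySubseq k (λ v → all p v ∧ g (x ∷ v)) xs ∨ anySubseq (suc k) g (filterᵇ p xs)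
    ≡⟨ cong (_∨ anySubseq (suc k) g (filterᵇ p xs)) (anySubseq-filter k p (g ∘ (x ∷_)) xs) ⟩
  anySubseq k (g ∘ (x ∷_)) (filterᵇ p xs) ∨ anySubseq (suc k) g (filterᵇ p xs)
    ≡⟨ anySubseq-cons k g x (filterᵇ p xs) ⟨
  anySubseq (suc k) g (x ∷ filterᵇ p xs) ∎
... | false = begin
  anySubseq (suc k) (λ v → all p v ∧ g v) (x ∷ xs)
    ≡⟨ anySubseq-cons k _ x xs ⟩
  anySubseq k (λ v → (p x ∧ all p v) ∧ g (x ∷ v)) xs ∨ anySubseq (suc k) (λ v → all p v ∧ g v) xs
    ≡⟨ cong₂ _∨_ (trans (anySubseq-cong k (λ v _ → cong (λ b → (b ∧ all p v) ∧ g (x ∷ v)) px) xs)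
                        (anySubseq-false k xs))
                 (anySubseq-filter (suc k) p g xs) ⟩
  anySubseq (suc k) g (filterᵇ p xs) ∎

-- The forbidden shape

isPair : List ℕ → Bool
isPair (_ ∷ _ ∷ []) = true
isPair _ = false

isFork : List ℕ → Bool
isFork [] = false
isFork (b ∷ v) = all (b ≥ᵇ_) v ∧ isPair v

isForkAfterOne : List ℕ → Bool
isForkAfterOne [] = false
isForkAfterOne (_ ∷ v) = isFork v

isForbidden : List ℕ → Bool
isForbidden [] = false
isForbidden (e ∷ v) = all (e ≥ᵇ_) v ∧ isForkAfterOne v

hasPair : List ℕ → Bool
hasPair (_ ∷ _ ∷ _) = true
hasPair _ = false

hasFork : List ℕ → Bool
hasFork [] = false
hasFork (b ∷ v) = hasPair (filterᵇ (b ≥ᵇ_) v) ∨ hasFork v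

hasForkAfterOne : List ℕ → Bool
hasForkAfterOne [] = false
hasForkAfterOne (_ ∷ v) = hasFork v

isG3 : List ℕ → Bool
isG3 [] = true
isG3 (x ∷ xs) = not (hasForkAfterOne (filterᵇ (x ≥ᵇ_) xs)) ∧ isG3 xs

anySubseq-isPair : ∀ π → anySubseq 2 isPair π ≡ hasPair π
anySubseq-isPair [] = refl
anySubseq-isPair (y ∷ []) = anySubseq-cons 1 isPair y []
anySubseq-isPair (y ∷ z ∷ zs) =
  trans (anySubseq-cons 1 isPair y (z ∷ zs))
        (cong (_∨ anySubseq 2 isPair (z ∷ zs)) (anySubseq-cons 0 (isPair ∘ (y ∷_)) z zs))

anySubseq-isFork : ∀ π → anySubseq 3 isFork π ≡ hasFork π
anySubseq-isFork [] = refl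
anySubseq-isFork (b ∷ v) = trans (anySubseq-cons 2 isFork b v)
  (cong₂ _∨_ (trans (anySubseq-filter 2 (b ≥ᵇ_) isPair v) (anySubseq-isPair (filterᵇ (b ≥ᵇ_) v)))
             (anySubseq-isFork v))

hasForkAfterOne⇒hasFork : ∀ π → hasForkAfterOne π ≡ true → hasFork π ≡ true
hasForkAfterOne⇒hasFork (a ∷ v) h = trans (cong (hasPair (filterᵇ (a ≥ᵇ_) v) ∨_) h) (∨-zeroʳ _)

anySubseq-isForkAfterOne : ∀ π → anySubseq 4 isForkAfterOne π ≡ hasForkAfterOne π
anySubseq-isForkAfterOne [] = refl
anySubseq-isForkAfterOne (a ∷ v) = begin
  anySubseq 4 isForkAfterOne (a ∷ v)
    ≡⟨ anySubseq-cons 3 isForkAfterOne a v ⟩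
  anySubseq 3 isFork v ∨ anySubseq 4 isForkAfterOne v
    ≡⟨ cong₂ _∨_ (anySubseq-isFork v) (anySubseq-isForkAfterOne v) ⟩
  hasFork v ∨ hasForkAfterOne v
    ≡⟨ absorb (hasFork v) (hasForkAfterOne v) (hasForkAfterOne⇒hasFork v) ⟩
  hasFork v ∎
  where
  absorb : ∀ x y → (y ≡ true → x ≡ true) → x ∨ y ≡ x
  absorb true y _ = refl
  absorb false true y⇒x = sym (y⇒x refl)
  absorb false false _ = refl

anySubseq-isForbidden : ∀ π → anySubseq 5 isForbidden π ≡ not (isG3 π)
anySubseq-isForbidden [] = refl
anySubseq-isForbidden (x ∷ xs) = begin
  anySubseq 5 isForbidden (x ∷ xs)
    ≡⟨ anySubseq-cons 4 isForbidden x xs ⟩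
  anySubseq 4 (λ v → all (x ≥ᵇ_) v ∧ isForkAfterOne v) xs ∨ anySubseq 5 isForbidden xs
    ≡⟨ cong₂ _∨_ (trans (anySubseq-filter 4 (x ≥ᵇ_) isForkAfterOne xs)
                        (anySubseq-isForkAfterOne (filterᵇ (x ≥ᵇ_) xs)))
                 (anySubseq-isForbidden xs) ⟩
  hasForkAfterOne (filterᵇ (x ≥ᵇ_) xs) ∨ not (isG3 xs)
    ≡⟨ de-morgan (hasForkAfterOne (filterᵇ (x ≥ᵇ_) xs)) (isG3 xs) ⟩
  not (isG3 (x ∷ xs)) ∎
  where
  de-morgan : ∀ a b → a ∨ not b ≡ not (not a ∧ b)
  de-morgan true b = refl
  de-morgan false b = refl

matchesBasis : List ℕ → Bool
matchesBasis w = any (λ σ → orderIso σ w) G3basis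

<-≤-≤-irrefl : ∀ {x y z} → x < y → y ≤ z → z ≤ x → ⊥
<-≤-≤-irrefl x<y y≤z z≤x = <-irrefl refl (<-≤-trans x<y (≤-trans y≤z z≤x))

-- Once e is the largest entry and b exceeds c and d, the eight patterns are the
-- eight relative orders of a, c, d compatible with that; the other outcomes of
-- the comparisons are inconsistent with transitivity.
matchesBasis≡isForbidden : ∀ w → length w ≡ 5 → matchesBasis w ≡ isForbidden w
matchesBasis≡isForbidden (e ∷ a ∷ b ∷ c ∷ d ∷ []) _
  with e <ᵇ a | e <ᵇ b | e <ᵇ c | e <ᵇ d
     | a <ᵇ b in ab | a <ᵇ c in ac | a <ᵇ d in ad | b <ᵇ c in bc | b <ᵇ d in bd | c <ᵇ d in cd
... | true  | _     | _     | _     | _     | _     | _     | _     | _     | _     = refl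
... | false | true  | _     | _     | _     | _     | _     | _     | _     | _     = refl
... | false | false | true  | _     | _     | _     | _     | _     | _     | _     = refl
... | false | false | false | true  | _     | _     | _     | _     | _     | _     = refl
... | false | false | false | false | false | true  | _     | false | false | _     =
  ⊥-elim (<-≤-≤-irrefl (<ᵇ≡true⇒< a c ac) (<ᵇ≡false⇒≥ b c bc) (<ᵇ≡false⇒≥ a b ab))
... | false | false | false | false | false | _     | true  | false | false | _     =
  ⊥-elim (<-≤-≤-irrefl (<ᵇ≡true⇒< a d ad) (<ᵇ≡false⇒≥ b d bd) (<ᵇ≡false⇒≥ a b ab))
... | false | false | false | false | _     | false | true  | _     | _     | false =
  ⊥-elim (<-≤-≤-irrefl (<ᵇ≡true⇒< a d ad) (<ᵇ≡false⇒≥ c d cd) (<ᵇ≡false⇒≥ a c ac))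
... | false | false | false | false | _     | true  | false | _     | _     | true  =
  ⊥-elim (<-≤-≤-irrefl (<ᵇ≡true⇒< a c ac) (<⇒≤ (<ᵇ≡true⇒< c d cd)) (<ᵇ≡false⇒≥ a d ad))
... | false | false | false | false | false | false | false | true  | _     | _     = refl
... | false | false | false | false | false | false | true  | true  | _     | _     = refl
... | false | false | false | false | false | true  | false | true  | _     | _     = refl
... | false | false | false | false | false | true  | true  | true  | _     | _     = refl
... | false | false | false | false | true  | false | false | true  | _     | _     = refl
... | false | false | false | false | true  | false | true  | true  | _     | _     = refl
... | false | false | false | false | true  | true  | false | true  | _     | _     = refl
... | false | false | false | false | true  | true  | true  | true  | _     | _     = refl
... | false | false | false | false | false | false | false | false | true  | _     = refl
... | false | false | false | false | false | false | true  | false | true  | _     = refl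
... | false | false | false | false | false | true  | false | false | true  | _     = refl
... | false | false | false | false | false | true  | true  | false | true  | _     = refl
... | false | false | false | false | true  | false | false | false | true  | _     = refl
... | false | false | false | false | true  | false | true  | false | true  | _     = refl
... | false | false | false | false | true  | true  | false | false | true  | _     = refl
... | false | false | false | false | true  | true  | true  | false | true  | _     = refl
... | false | false | false | false | false | false | false | false | false | false = refl
... | false | false | false | false | false | false | false | false | false | true  = refl
... | false | false | false | false | true  | false | false | false | false | false = refl
... | false | false | false | false | true  | false | false | false | false | true  = refl
... | false | false | false | false | true  | false | true  | false | false | true  = refl
... | false | false | false | false | true  | true  | false | false | false | false = refl
... | false | false | false | false | true  | true  | true  | false | false | false = refl
... | false | false | false | false | true  | true  | true  | false | false | true  = refl

avoids-G3basis : ∀ π → avoids G3basis π ≡ isG3 π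
avoids-G3basis π = begin
  all (λ σ → not (contains π σ)) G3basis
    ≡⟨ all-not (contains π) G3basis ⟩
  not (any (λ σ → any (orderIso σ) (subseqs 5 π)) G3basis)
    ≡⟨ cong not (any-comm orderIso G3basis (subseqs 5 π)) ⟩
  not (anySubseq 5 matchesBasis π)
    ≡⟨ cong not (anySubseq-cong 5 matchesBasis≡isForbidden π) ⟩
  not (anySubseq 5 isForbidden π)
    ≡⟨ cong not (anySubseq-isForbidden π) ⟩
  not (not (isG3 π))
    ≡⟨ not-involutive (isG3 π) ⟩
  isG3 π ∎

-- Inserting the maximum: the generating tree

filterᵇ-≥-insert : ∀ {x n} → x < n → ∀ xs ys →
                   filterᵇ (x ≥ᵇ_) (xs ++ n ∷ ys) ≡ filterᵇ (x ≥ᵇ_) (xs ++ ys)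
filterᵇ-≥-insert x<n [] ys rewrite <⇒<ᵇ≡true x<n = refl
filterᵇ-≥-insert {x} x<n (z ∷ xs) ys with x ≥ᵇ z
... | true = cong (z ∷_) (filterᵇ-≥-insert x<n xs ys)
... | false = filterᵇ-≥-insert x<n xs ys

filterᵇ-≥-all : ∀ {n} ys → All (_< n) ys → filterᵇ (n ≥ᵇ_) ys ≡ ys
filterᵇ-≥-all [] [] = refl
filterᵇ-≥-all (y ∷ ys) (y<n ∷ ys<n) rewrite ≥⇒<ᵇ≡false (<⇒≤ y<n) =
  cong (y ∷_) (filterᵇ-≥-all ys ys<n)

isG3-insert : ∀ {n} xs ys → All (_< n) (xs ++ ys) →
              isG3 (xs ++ n ∷ ys) ≡ isG3 (xs ++ ys) ∧ not (hasForkAfterOne ys)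
isG3-insert [] ys ys<n rewrite filterᵇ-≥-all ys ys<n = ∧-comm (not (hasForkAfterOne ys)) (isG3 ys)
isG3-insert (x ∷ xs) ys (x<n ∷ xs++ys<n) rewrite filterᵇ-≥-insert x<n xs ys | isG3-insert xs ys xs++ys<n =
  sym (∧-assoc (not (hasForkAfterOne (filterᵇ (x ≥ᵇ_) (xs ++ ys)))) (isG3 (xs ++ ys)) _)

-- The length of the longest fork-free suffix.
label : List ℕ → ℕ
label [] = 0
label (y ∷ w) = if hasFork (y ∷ w) then label w else suc (length w)

hasFork-++ˡ : ∀ xs w → hasFork w ≡ true → hasFork (xs ++ w) ≡ true
hasFork-++ˡ [] w h = h
hasFork-++ˡ (x ∷ xs) w h rewrite hasFork-++ˡ xs w h = ∨-zeroʳ _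

label-++ˡ : ∀ xs w → hasFork w ≡ true → label (xs ++ w) ≡ label w
label-++ˡ [] w h = refl
label-++ˡ (x ∷ xs) w h rewrite hasFork-++ˡ (x ∷ xs) w h = label-++ˡ xs w h

label-forkFree : ∀ w → hasFork w ≡ false → label w ≡ length w
label-forkFree [] h = refl
label-forkFree (y ∷ w) h rewrite h = refl

label≤length : ∀ w → label w ≤ length w
label≤length [] = z≤n
label≤length (y ∷ w) with hasFork (y ∷ w)
... | true = ≤-trans (label≤length w) (n≤1+n _)
... | false = ≤-refl

hasFork-suffix : ∀ xs ys → hasFork ys ≡ (label (xs ++ ys) <ᵇ length ys)
hasFork-suffix [] [] = refl
hasFork-suffix [] (y ∷ v) with hasFork (y ∷ v)
... | true = sym (<⇒<ᵇ≡true (s≤s (label≤length v)))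
... | false = sym (≥⇒<ᵇ≡false (≤-refl {length v}))
hasFork-suffix (x ∷ xs) ys with hasFork ys in h
... | true rewrite hasFork-++ˡ (x ∷ xs) ys h = trans (sym h) (hasFork-suffix xs ys)
... | false with hasFork (x ∷ (xs ++ ys))
...   | true = trans (sym h) (hasFork-suffix xs ys)
...   | false = sym (≥⇒<ᵇ≡false (≤-trans ys≤xs++ys (n≤1+n _)))
  where
  ys≤xs++ys : length ys ≤ length (xs ++ ys)
  ys≤xs++ys = subst (length ys ≤_) (sym (length-++ xs)) (m≤n+m (length ys) (length xs))

hasForkAfterOne-suffix : ∀ xs ys → hasForkAfterOne ys ≡ (suc (label (xs ++ ys)) <ᵇ length ys)
hasForkAfterOne-suffix xs [] = refl
hasForkAfterOne-suffix xs (a ∷ v) =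
  trans (hasFork-suffix (xs ++ a ∷ []) v) (cong (λ w → label w <ᵇ length v) (++-assoc xs (a ∷ []) v))

hasFork-short : ∀ ys → length ys < 2 → hasFork ys ≡ false
hasFork-short [] _ = refl
hasFork-short (_ ∷ []) _ = refl
hasFork-short (_ ∷ _ ∷ _) (s≤s (s≤s ()))

hasPair-short : ∀ ys → length ys < 2 → hasPair ys ≡ false
hasPair-short [] _ = refl
hasPair-short (_ ∷ []) _ = refl
hasPair-short (_ ∷ _ ∷ _) (s≤s (s≤s ()))

hasFork-insert-short : ∀ {n} xs ys → length ys < 2 → All (_< n) (xs ++ ys) →
                       hasFork (xs ++ n ∷ ys) ≡ hasFork (xs ++ ys)
hasFork-insert-short [] ys short ys<n rewrite filterᵇ-≥-all ys ys<n | hasPair-short ys short = refl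
hasFork-insert-short (x ∷ xs) ys short (x<n ∷ rest<n)
  rewrite filterᵇ-≥-insert x<n xs ys | hasFork-insert-short xs ys short rest<n = refl

label-insert-short : ∀ {n} xs ys → length ys < 2 → All (_< n) (xs ++ ys) →
                     label (xs ++ n ∷ ys) ≡ suc (label (xs ++ ys))
label-insert-short {n} [] ys short ys<n
  rewrite hasFork-insert-short {n} [] ys short ys<n | hasFork-short ys short =
  cong suc (sym (label-forkFree ys (hasFork-short ys short)))
label-insert-short {n} (x ∷ xs) ys short (x<n ∷ rest<n)
  rewrite hasFork-insert-short (x ∷ xs) ys short (x<n ∷ rest<n) with hasFork (x ∷ (xs ++ ys))
... | true = label-insert-short xs ys short rest<n
... | false = cong suc (length-++-sucʳ xs n ys)

hasFork-max : ∀ {n} z₁ z₂ zs → All (_< n) (z₁ ∷ z₂ ∷ zs) → hasFork (n ∷ z₁ ∷ z₂ ∷ zs) ≡ true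
hasFork-max z₁ z₂ zs zs<n rewrite filterᵇ-≥-all (z₁ ∷ z₂ ∷ zs) zs<n = refl

-- The label of the child obtained by inserting the maximum with s entries after it.
childLabel : ℕ → ℕ → ℕ
childLabel m s = if s <ᵇ 2 then suc m else (if m <ᵇ s then m else s)

label-insert : ∀ {n} xs ys → All (_< n) (xs ++ ys) →
               label (xs ++ n ∷ ys) ≡ childLabel (label (xs ++ ys)) (length ys)
label-insert xs [] xs<n = label-insert-short xs [] (s≤s z≤n) xs<n
label-insert xs (z ∷ []) xs<n = label-insert-short xs (z ∷ []) (s≤s (s≤s z≤n)) xs<n
label-insert {n} xs ys@(z₁ ∷ z₂ ∷ zs) xs++ys<n = begin
  label (xs ++ n ∷ ys)
    ≡⟨ label-++ˡ xs (n ∷ ys) n-fork ⟩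
  label (n ∷ ys)
    ≡⟨ cong (λ b → if b then label ys else suc (length ys)) n-fork ⟩
  label ys
    ≡⟨ label-suffix (hasFork ys) refl ⟩
  (if hasFork ys then label (xs ++ ys) else length ys)
    ≡⟨ cong (λ b → if b then label (xs ++ ys) else length ys) (hasFork-suffix xs ys) ⟩
  childLabel (label (xs ++ ys)) (length ys) ∎
  where
  n-fork : hasFork (n ∷ ys) ≡ true
  n-fork = hasFork-max z₁ z₂ zs (++⁻ʳ xs xs++ys<n)
  label-suffix : ∀ b → hasFork ys ≡ b → label ys ≡ (if b then label (xs ++ ys) else length ys)
  label-suffix true h = sym (label-++ˡ xs ys h)
  label-suffix false h = label-forkFree ys h

sumDesc : ℕ → (ℕ → ℕ) → ℕ
sumDesc zero g = 0
sumDesc (suc n) g = g n + sumDesc n g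

sumDesc-cong : ∀ N {g h : ℕ → ℕ} → (∀ i → i < N → g i ≡ h i) → sumDesc N g ≡ sumDesc N h
sumDesc-cong zero g≗h = refl
sumDesc-cong (suc N) g≗h = cong₂ _+_ (g≗h N ≤-refl) (sumDesc-cong N (λ i i<N → g≗h i (m<n⇒m<1+n i<N)))

sumDesc-zero : ∀ N → sumDesc N (λ _ → 0) ≡ 0
sumDesc-zero zero = refl
sumDesc-zero (suc N) = sumDesc-zero N

-- Sum of f over the labels of the children of a node with label m in S n:
-- inserting n with s entries after it is allowed exactly when s ≤ m + 1.
childSum : ℕ → ℕ → (ℕ → ℕ) → ℕ
childSum n m f = sumDesc (suc n) (λ s → if suc m <ᵇ s then 0 else f (childLabel m s))

weight : (ℕ → ℕ) → List ℕ → ℕ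
weight f π = if isG3 π then f (label π) else 0

insertionWeight : (ℕ → ℕ) → List ℕ → ℕ → ℕ
insertionWeight f π s = if isG3 π then (if suc (label π) <ᵇ s then 0 else f (childLabel (label π) s)) else 0

weight-insert : ∀ {n} f xs ys → All (_< n) (xs ++ ys) →
                weight f (xs ++ n ∷ ys) ≡ insertionWeight f (xs ++ ys) (length ys)
weight-insert f xs ys xs++ys<n
  rewrite isG3-insert xs ys xs++ys<n | label-insert xs ys xs++ys<n | hasForkAfterOne-suffix xs ys
  with isG3 (xs ++ ys)
... | false = refl
... | true with suc (label (xs ++ ys)) <ᵇ length ys
...   | true = refl
...   | false = refl

sum-weight-insertEverywhere : ∀ {n} f xs ys → All (_< n) (xs ++ ys) →
  sum (map (weight f ∘ (xs ++_)) (insertEverywhere n ys))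
  ≡ sumDesc (suc (length ys)) (insertionWeight f (xs ++ ys))
sum-weight-insertEverywhere f xs [] xs<n = cong (_+ 0) (weight-insert f xs [] xs<n)
sum-weight-insertEverywhere {n} f xs (y ∷ ys) xs++y∷ys<n =
  cong₂ _+_ (weight-insert f xs (y ∷ ys) xs++y∷ys<n) (begin
    sum (map (weight f ∘ (xs ++_)) (map (y ∷_) (insertEverywhere n ys)))
      ≡⟨ cong sum (sym (map-∘ (insertEverywhere n ys))) ⟩
    sum (map (weight f ∘ (xs ++_) ∘ (y ∷_)) (insertEverywhere n ys))
      ≡⟨ cong sum (map-cong (λ ρ → cong (weight f) (sym (++-assoc xs (y ∷ []) ρ)))
                            (insertEverywhere n ys)) ⟩
    sum (map (weight f ∘ ((xs ++ y ∷ []) ++_)) (insertEverywhere n ys))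
      ≡⟨ sum-weight-insertEverywhere f (xs ++ y ∷ []) ys (subst (All (_< n)) (sym reassoc) xs++y∷ys<n) ⟩
    sumDesc (suc (length ys)) (insertionWeight f ((xs ++ y ∷ []) ++ ys))
      ≡⟨ cong (sumDesc (suc (length ys)) ∘ insertionWeight f) reassoc ⟩
    sumDesc (suc (length ys)) (insertionWeight f (xs ++ y ∷ ys)) ∎)
  where
  reassoc : (xs ++ y ∷ []) ++ ys ≡ xs ++ y ∷ ys
  reassoc = ++-assoc xs (y ∷ []) ys

sum-weight-children : ∀ {n} f π → length π ≡ n → All (_< n) π →
  sum (map (weight f) (insertEverywhere n π)) ≡ (if isG3 π then childSum n (label π) f else 0)
sum-weight-children f π refl π<n with isG3 π in g
... | true = trans (sum-weight-insertEverywhere f [] π π<n) (sumDesc-cong (suc (length π)) (λ s _ → if-cong g))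
... | false = begin
  sum (map (weight f) (insertEverywhere _ π))
    ≡⟨ sum-weight-insertEverywhere f [] π π<n ⟩
  sumDesc (suc (length π)) (insertionWeight f π)
    ≡⟨ sumDesc-cong (suc (length π)) (λ s _ → if-cong g) ⟩
  sumDesc (suc (length π)) (λ _ → 0)
    ≡⟨ sumDesc-zero (suc (length π)) ⟩
  0 ∎

Fits : ℕ → List ℕ → Set
Fits n π = length π ≡ n × All (_< n) π

insertEverywhere-fits : ∀ n ys → All (_< n) ys →
  All (λ ρ → length ρ ≡ suc (length ys) × All (_< suc n) ρ) (insertEverywhere n ys)
insertEverywhere-fits n [] [] = (refl , n<1+n n ∷ []) ∷ []
insertEverywhere-fits n (y ∷ ys) (y<n ∷ ys<n) =
  (refl , n<1+n n ∷ m<n⇒m<1+n y<n ∷ All.map m<n⇒m<1+n ys<n)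
  ∷ map⁺ (All.map (λ (l , ρ<n) → cong suc l , m<n⇒m<1+n y<n ∷ ρ<n) (insertEverywhere-fits n ys ys<n))

S-fits : ∀ n → All (Fits n) (S n)
S-fits zero = (refl , []) ∷ []
S-fits (suc n) = concat⁺ (map⁺ (All.map children (S-fits n)))
  where
  children : ∀ {π} → Fits n π → All (Fits (suc n)) (insertEverywhere n π)
  children {π} (l , π<n) =
    All.map (λ (l′ , ρ<n) → trans l′ (cong suc l) , ρ<n) (insertEverywhere-fits n π π<n)

totalWeight : ℕ → (ℕ → ℕ) → ℕ
totalWeight n f = sum (map (weight f) (S n))

treeWeight : ℕ → (ℕ → ℕ) → ℕ
treeWeight zero f = f 0
treeWeight (suc n) f = treeWeight n (λ m → childSum n m f)

totalWeight-suc : ∀ n f → totalWeight (suc n) f ≡ totalWeight n (λ m → childSum n m f)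
totalWeight-suc n f = trans (sum-map-concatMap (weight f) (insertEverywhere n) (S n))
  (cong sum (map-cong-local (All.map (λ {π} (l , π<n) → sum-weight-children f π l π<n) (S-fits n))))

totalWeight≡treeWeight : ∀ n f → totalWeight n f ≡ treeWeight n f
totalWeight≡treeWeight zero f = +-identityʳ (f 0)
totalWeight≡treeWeight (suc n) f =
  trans (totalWeight-suc n f) (totalWeight≡treeWeight n (λ m → childSum n m f))

countG3≡treeWeight : ∀ n → countG3 n ≡ treeWeight n (λ _ → 1)
countG3≡treeWeight n = begin
  length (filterᵇ (avoids G3basis) (S n))
    ≡⟨ length-filterᵇ (avoids G3basis) (S n) ⟩
  sum (map (λ π → if avoids G3basis π then 1 else 0) (S n))
    ≡⟨ cong sum (map-cong (λ π → if-cong (avoids-G3basis π)) (S n)) ⟩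
  totalWeight n (λ _ → 1)
    ≡⟨ totalWeight≡treeWeight n (λ _ → 1) ⟩
  treeWeight n (λ _ → 1) ∎

-- Recurrences for the number of descendants

descendants : ℕ → ℕ → ℕ → ℕ
descendants zero n m = 1
descendants (suc k) n m = childSum n m (descendants k (suc n))

treeWeight-descendants : ∀ n k → treeWeight n (descendants k n) ≡ descendants (n + k) 0 0
treeWeight-descendants zero k = refl
treeWeight-descendants (suc n) k =
  trans (treeWeight-descendants n (suc k)) (cong (λ j → descendants j 0 0) (+-suc n k))

countG3≡descendants : ∀ n → countG3 n ≡ descendants n 0 0
countG3≡descendants n = begin
  countG3 n                         ≡⟨ countG3≡treeWeight n ⟩
  treeWeight n (descendants 0 n)    ≡⟨ treeWeight-descendants n 0 ⟩
  descendants (n + 0) 0 0           ≡⟨ cong (λ j → descendants j 0 0) (+-identityʳ n) ⟩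
  descendants n 0 0                 ∎

-- Depth-k descendants of a node with label m when the bound s ≤ n on the number s of
-- entries after the inserted maximum never binds.
D : ℕ → ℕ → ℕ
D zero m = 1
D (suc k) m = sumDesc (suc (suc m)) (λ s → D k (childLabel m s))

d : ℕ → ℕ
d k = D k 2

childLabel≤ : ∀ m s → childLabel m s ≤ suc m
childLabel≤ m s with s <ᵇ 2
... | true = ≤-refl
... | false with m <ᵇ s in m<s
...   | true = n≤1+n m
...   | false = ≤-trans (<ᵇ≡false⇒≥ m s m<s) (n≤1+n m)

childLabel-≤ : ∀ m s → s ≤ m → childLabel m s ≡ (if s <ᵇ 2 then suc m else s)
childLabel-≤ m s s≤m with s <ᵇ 2
... | true = refl
... | false rewrite ≥⇒<ᵇ≡false s≤m = refl

sumDesc-truncate : ∀ c N F → suc c ≤ N →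
                   sumDesc N (λ s → if c <ᵇ s then 0 else F s) ≡ sumDesc (suc c) F
sumDesc-truncate c (suc N) F (s≤s c≤N) with c ≟ N
... | yes refl = cong₂ _+_ (if-cong (≥⇒<ᵇ≡false (≤-refl {c})))
                          (sumDesc-cong c (λ i i<c → if-cong (≥⇒<ᵇ≡false (<⇒≤ i<c))))
... | no c≢N = trans (cong (_+ sumDesc N (λ s → if c <ᵇ s then 0 else F s)) (if-cong (<⇒<ᵇ≡true c<N)))
                     (sumDesc-truncate c N F c<N)
  where
  c<N : c < N
  c<N = ≤∧≢⇒< c≤N c≢N

descendants≡D : ∀ k n m → m < n → descendants k n m ≡ D k m
descendants≡D zero n m m<n = refl
descendants≡D (suc k) n m m<n = trans
  (sumDesc-cong (suc n) (λ s _ → if-cong-else (suc m <ᵇ s)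
    (descendants≡D k (suc n) (childLabel m s) (s≤s (≤-trans (childLabel≤ m s) m<n)))))
  (sumDesc-truncate (suc m) (suc n) (λ s → D k (childLabel m s)) (s≤s m<n))

Φ : ℕ → ℕ → ℕ
Φ k n = descendants k n n

D≥2-sum : ℕ → ℕ → ℕ
D≥2-sum k m = sumDesc (suc m) (λ j → if j <ᵇ 2 then 0 else D k j)

D≥2-sum-suc : ∀ k m → 1 ≤ m → D≥2-sum k (suc m) ≡ D k (suc m) + D≥2-sum k m
D≥2-sum-suc k (suc m) _ = refl

sumDesc-split2 : ∀ m → 1 ≤ m → ∀ X (F : ℕ → ℕ) →
  sumDesc (suc m) (λ s → if s <ᵇ 2 then X else F s)
  ≡ 2 * X + sumDesc (suc m) (λ s → if s <ᵇ 2 then 0 else F s)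
sumDesc-split2 (suc zero) _ X F = base X
  where
  base : ∀ x → x + (x + 0) ≡ (x + (x + 0)) + 0
  base = solve-∀
sumDesc-split2 (suc (suc m)) _ X F =
  trans (cong (_+_ (F (suc (suc m)))) (sumDesc-split2 (suc m) (s≤s z≤n) X F))
    (step (F (suc (suc m))) X (sumDesc (suc (suc m)) (λ s → if s <ᵇ 2 then 0 else F s)))
  where
  step : ∀ f x r → f + (2 * x + r) ≡ 2 * x + (f + r)
  step = solve-∀

D-suc : ∀ k m → 1 ≤ m → D (suc k) m ≡ 2 * D k (suc m) + D k m + D≥2-sum k m
D-suc k (suc m) _ = begin
  D k (childLabel (suc m) (suc (suc m))) + sumDesc (suc (suc m)) (λ s → D k (childLabel (suc m) s))
    ≡⟨ cong₂ _+_ (cong (D k) (if-cong (<⇒<ᵇ≡true (n<1+n (suc m)))))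
                 (sumDesc-cong (suc (suc m)) (λ s s< →
                   trans (cong (D k) (childLabel-≤ (suc m) s (≤-pred s<))) (if-float (D k) (s <ᵇ 2)))) ⟩
  D k (suc m) + sumDesc (suc (suc m)) (λ s → if s <ᵇ 2 then D k (suc (suc m)) else D k s)
    ≡⟨ cong (_+_ (D k (suc m))) (sumDesc-split2 (suc m) (s≤s z≤n) (D k (suc (suc m))) (D k)) ⟩
  D k (suc m) + (2 * D k (suc (suc m)) + D≥2-sum k (suc m))
    ≡⟨ regroup (D k (suc m)) (D k (suc (suc m))) (D≥2-sum k (suc m)) ⟩
  2 * D k (suc (suc m)) + D k (suc m) + D≥2-sum k (suc m) ∎
  where
  regroup : ∀ x y z → x + (2 * y + z) ≡ 2 * y + x + z
  regroup = solve-∀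

Φ-suc : ∀ k n → 1 ≤ n → Φ (suc k) n ≡ 2 * Φ k (suc n) + D≥2-sum k n
Φ-suc k n 1≤n = begin
  sumDesc (suc n) (λ s → if suc n <ᵇ s then 0 else descendants k (suc n) (childLabel n s))
    ≡⟨ sumDesc-cong (suc n) (λ s s< → child s (≤-pred s<)) ⟩
  sumDesc (suc n) (λ s → if s <ᵇ 2 then Φ k (suc n) else D k s)
    ≡⟨ sumDesc-split2 n 1≤n (Φ k (suc n)) (D k) ⟩
  2 * Φ k (suc n) + D≥2-sum k n ∎
  where
  child : ∀ s → s ≤ n → (if suc n <ᵇ s then 0 else descendants k (suc n) (childLabel n s))
                        ≡ (if s <ᵇ 2 then Φ k (suc n) else D k s)
  child s s≤n rewrite ≥⇒<ᵇ≡false {suc n} {s} (≤-trans s≤n (n≤1+n n)) | childLabel-≤ n s s≤n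
    with s <ᵇ 2
  ... | true = refl
  ... | false = descendants≡D k (suc n) s (s≤s s≤n)

Φ-suc-zero : ∀ k → Φ (suc k) 0 ≡ Φ k 1
Φ-suc-zero k = +-identityʳ (Φ k 1)

Φ-suc′ : ∀ k n → 1 ≤ n → Φ (suc k) n ≡ Φ k n + D≥2-sum k (suc n)
Φ-suc′ zero n 1≤n = trans (Φ-suc 0 n 1≤n) (cong suc (sym (D≥2-sum-suc 0 n 1≤n)))
Φ-suc′ (suc k) n 1≤n = begin
  Φ (suc (suc k)) n
    ≡⟨ Φ-suc (suc k) n 1≤n ⟩
  2 * Φ (suc k) (suc n) + D≥2-sum (suc k) n
    ≡⟨ cong (λ z → 2 * z + D≥2-sum (suc k) n) (Φ-suc′ k (suc n) (s≤s z≤n)) ⟩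
  2 * (Φ k (suc n) + D≥2-sum k (suc (suc n))) + D≥2-sum (suc k) n
    ≡⟨ cong (λ z → 2 * (Φ k (suc n) + z) + D≥2-sum (suc k) n) sum-n+2 ⟩
  2 * (Φ k (suc n) + (D₂ + (D₁ + D≥2-sum k n))) + D≥2-sum (suc k) n
    ≡⟨ regroup (Φ k (suc n)) D₂ D₁ (D≥2-sum k n) (D≥2-sum (suc k) n) ⟩
  (2 * Φ k (suc n) + D≥2-sum k n) + ((2 * D₂ + D₁ + (D₁ + D≥2-sum k n)) + D≥2-sum (suc k) n)
    ≡⟨ cong₂ (λ u v → u + (v + D≥2-sum (suc k) n)) (sym (Φ-suc k n 1≤n)) (sym D-suc-n+1) ⟩
  Φ (suc k) n + (D (suc k) (suc n) + D≥2-sum (suc k) n)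
    ≡⟨ cong (_+_ (Φ (suc k) n)) (sym (D≥2-sum-suc (suc k) n 1≤n)) ⟩
  Φ (suc k) n + D≥2-sum (suc k) (suc n) ∎
  where
  D₁ = D k (suc n)
  D₂ = D k (suc (suc n))
  sum-n+2 : D≥2-sum k (suc (suc n)) ≡ D₂ + (D₁ + D≥2-sum k n)
  sum-n+2 = trans (D≥2-sum-suc k (suc n) (s≤s z≤n)) (cong (_+_ D₂) (D≥2-sum-suc k n 1≤n))
  D-suc-n+1 : D (suc k) (suc n) ≡ 2 * D₂ + D₁ + (D₁ + D≥2-sum k n)
  D-suc-n+1 = trans (D-suc k (suc n) (s≤s z≤n)) (cong (_+_ (2 * D₂ + D₁)) (D≥2-sum-suc k n 1≤n))
  regroup : ∀ p x y s t → 2 * (p + (x + (y + s))) + t ≡ (2 * p + s) + ((2 * x + y + (y + s)) + t)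
  regroup = solve-∀

descendants-root : ∀ k → descendants (suc (suc k)) 0 0 ≡ descendants (suc k) 0 0 + d k
descendants-root k = begin
  Φ (suc (suc k)) 0      ≡⟨ Φ-suc-zero (suc k) ⟩
  Φ (suc k) 1            ≡⟨ Φ-suc′ k 1 (s≤s z≤n) ⟩
  Φ k 1 + (d k + 0)      ≡⟨ cong₂ _+_ (sym (Φ-suc-zero k)) (+-identityʳ (d k)) ⟩
  Φ (suc k) 0 + d k      ∎

sumAsc : ℕ → (ℕ → ℕ) → ℕ
sumAsc zero g = 0
sumAsc (suc n) g = g 0 + sumAsc n (g ∘ suc)

sumAsc-cong : ∀ n {g h : ℕ → ℕ} → (∀ i → i < n → g i ≡ h i) → sumAsc n g ≡ sumAsc n h
sumAsc-cong zero g≗h = refl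
sumAsc-cong (suc n) g≗h =
  cong₂ _+_ (g≗h 0 (s≤s z≤n)) (sumAsc-cong n (λ i i<n → g≗h (suc i) (s≤s i<n)))

sumAsc-zero : ∀ n → sumAsc n (λ _ → 0) ≡ 0
sumAsc-zero zero = refl
sumAsc-zero (suc n) = sumAsc-zero n

sumAsc-+ : ∀ n (g h : ℕ → ℕ) → sumAsc n (λ i → g i + h i) ≡ sumAsc n g + sumAsc n h
sumAsc-+ zero g h = refl
sumAsc-+ (suc n) g h = trans (cong (_+_ (g 0 + h 0)) (sumAsc-+ n (g ∘ suc) (h ∘ suc)))
  (interchange (g 0) (h 0) (sumAsc n (g ∘ suc)) (sumAsc n (h ∘ suc)))
  where
  interchange : ∀ a b c e → a + b + (c + e) ≡ a + c + (b + e)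
  interchange = solve-∀

sumAsc-* : ∀ n c (g : ℕ → ℕ) → sumAsc n (λ i → c * g i) ≡ c * sumAsc n g
sumAsc-* zero c g = sym (*-zeroʳ c)
sumAsc-* (suc n) c g =
  trans (cong (_+_ (c * g 0)) (sumAsc-* n c (g ∘ suc))) (sym (*-distribˡ-+ c (g 0) (sumAsc n (g ∘ suc))))

sumAsc-suc : ∀ n g → sumAsc (suc n) g ≡ sumAsc n g + g n
sumAsc-suc zero g = +-identityʳ (g 0)
sumAsc-suc (suc n) g = trans (cong (_+_ (g 0)) (sumAsc-suc n (g ∘ suc))) (sym (+-assoc (g 0) _ _))

infixl 7 _∗_

_∗_ : (ℕ → ℕ) → (ℕ → ℕ) → ℕ → ℕ
(f ∗ g) n = sumAsc (suc n) (λ i → f i * g (n ∸ i))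

shift : (ℕ → ℕ) → ℕ → ℕ
shift f zero = 0
shift f (suc k) = f k

δ : ℕ → ℕ
δ zero = 1
δ (suc _) = 0

∗-congˡ : ∀ n {f f′} g → (∀ i → i ≤ n → f i ≡ f′ i) → (f ∗ g) n ≡ (f′ ∗ g) n
∗-congˡ n g f≗f′ = sumAsc-cong (suc n) (λ i i≤n → cong (_* g (n ∸ i)) (f≗f′ i (≤-pred i≤n)))

∗-congʳ : ∀ n f {g g′} → (∀ i → i ≤ n → g i ≡ g′ i) → (f ∗ g) n ≡ (f ∗ g′) n
∗-congʳ n f g≗g′ = sumAsc-cong (suc n) (λ i _ → cong (f i *_) (g≗g′ (n ∸ i) (m∸n≤m n i)))

∗-distribʳ-+ : ∀ n (f f′ g : ℕ → ℕ) → ((λ i → f i + f′ i) ∗ g) n ≡ (f ∗ g) n + (f′ ∗ g) n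
∗-distribʳ-+ n f f′ g = trans (sumAsc-cong (suc n) (λ i _ → *-distribʳ-+ (g (n ∸ i)) (f i) (f′ i)))
  (sumAsc-+ (suc n) (λ i → f i * g (n ∸ i)) (λ i → f′ i * g (n ∸ i)))

∗-distribˡ-+ : ∀ n (f g g′ : ℕ → ℕ) → (f ∗ (λ i → g i + g′ i)) n ≡ (f ∗ g) n + (f ∗ g′) n
∗-distribˡ-+ n f g g′ = trans (sumAsc-cong (suc n) (λ i _ → *-distribˡ-+ (f i) (g (n ∸ i)) (g′ (n ∸ i))))
  (sumAsc-+ (suc n) (λ i → f i * g (n ∸ i)) (λ i → f i * g′ (n ∸ i)))

∗-scaleˡ : ∀ n c (f g : ℕ → ℕ) → ((λ i → c * f i) ∗ g) n ≡ c * (f ∗ g) n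
∗-scaleˡ n c f g = trans (sumAsc-cong (suc n) (λ i _ → *-assoc c (f i) (g (n ∸ i))))
  (sumAsc-* (suc n) c (λ i → f i * g (n ∸ i)))

shift-∗ : ∀ n f g → (shift f ∗ g) n ≡ shift (f ∗ g) n
shift-∗ zero f g = refl
shift-∗ (suc n) f g = refl

∗-shift : ∀ n f g → (f ∗ shift g) n ≡ shift (f ∗ g) n
∗-shift zero f g = cong (_+ 0) (*-zeroʳ (f 0))
∗-shift (suc n) f g = begin
  sumAsc (suc (suc n)) (λ i → f i * shift g (suc n ∸ i))
    ≡⟨ sumAsc-suc (suc n) (λ i → f i * shift g (suc n ∸ i)) ⟩
  sumAsc (suc n) (λ i → f i * shift g (suc n ∸ i)) + f (suc n) * shift g (suc n ∸ suc n)
    ≡⟨ cong₂ _+_ (sumAsc-cong (suc n) (λ i i≤n → cong (λ j → f i * shift g j) (+-∸-assoc 1 (≤-pred i≤n))))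
                 (trans (cong (λ j → f (suc n) * shift g j) (n∸n≡0 n)) (*-zeroʳ (f (suc n)))) ⟩
  (f ∗ g) n + 0
    ≡⟨ +-identityʳ _ ⟩
  (f ∗ g) n ∎

δ-∗ : ∀ n g → (δ ∗ g) n ≡ g n
δ-∗ n g = trans (cong (λ z → g n + 0 + z) (sumAsc-zero n)) (trans (+-identityʳ _) (+-identityʳ (g n)))

∗-δ : ∀ n g → (g ∗ δ) n ≡ g n
∗-δ n g = begin
  sumAsc (suc n) (λ i → g i * δ (n ∸ i))
    ≡⟨ sumAsc-suc n (λ i → g i * δ (n ∸ i)) ⟩
  sumAsc n (λ i → g i * δ (n ∸ i)) + g n * δ (n ∸ n)
    ≡⟨ cong₂ _+_ (trans (sumAsc-cong n (λ i i<n → trans (cong (λ j → g i * δ j) (+-∸-assoc 1 i<n))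
                                                          (*-zeroʳ (g i))))
                        (sumAsc-zero n))
                 (trans (cong (λ j → g n * δ j) (n∸n≡0 n)) (*-identityʳ (g n))) ⟩
  g n ∎

∗-assoc : ∀ n (f g h : ℕ → ℕ) → ((f ∗ g) ∗ h) n ≡ (f ∗ (g ∗ h)) n
∗-assoc zero f g h = base (f 0) (g 0) (h 0)
  where
  base : ∀ x y z → (x * y + 0) * z + 0 ≡ x * (y * z + 0) + 0
  base = solve-∀
∗-assoc (suc n) f g h = begin
  ((f ∗ g) ∗ h) (suc n)
    ≡⟨⟩
  (f 0 * g 0 + 0) * h (suc n) + sumAsc (suc n) (λ i → (f 0 * g (suc i) + (f′ ∗ g) i) * h (n ∸ i))
    ≡⟨ cong (_+_ ((f 0 * g 0 + 0) * h (suc n))) split ⟩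
  (f 0 * g 0 + 0) * h (suc n) + (f 0 * sumAsc (suc n) (λ i → g (suc i) * h (n ∸ i)) + ((f′ ∗ g) ∗ h) n)
    ≡⟨ cong (λ z → (f 0 * g 0 + 0) * h (suc n) + (f 0 * sumAsc (suc n) (λ i → g (suc i) * h (n ∸ i)) + z))
            (∗-assoc n f′ g h) ⟩
  (f 0 * g 0 + 0) * h (suc n) + (f 0 * sumAsc (suc n) (λ i → g (suc i) * h (n ∸ i)) + (f′ ∗ (g ∗ h)) n)
    ≡⟨ regroup (f 0) (g 0) (h (suc n)) (sumAsc (suc n) (λ i → g (suc i) * h (n ∸ i)))
               ((f′ ∗ (g ∗ h)) n) ⟩
  (f ∗ (g ∗ h)) (suc n) ∎
  where
  f′ : ℕ → ℕ
  f′ = f ∘ suc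
  split : sumAsc (suc n) (λ i → (f 0 * g (suc i) + (f′ ∗ g) i) * h (n ∸ i))
          ≡ f 0 * sumAsc (suc n) (λ i → g (suc i) * h (n ∸ i)) + ((f′ ∗ g) ∗ h) n
  split = begin
    sumAsc (suc n) (λ i → (f 0 * g (suc i) + (f′ ∗ g) i) * h (n ∸ i))
      ≡⟨ ∗-distribʳ-+ n (λ i → f 0 * g (suc i)) (f′ ∗ g) h ⟩
    ((λ i → f 0 * g (suc i)) ∗ h) n + ((f′ ∗ g) ∗ h) n
      ≡⟨ cong (_+ ((f′ ∗ g) ∗ h) n) (∗-scaleˡ n (f 0) (g ∘ suc) h) ⟩
    f 0 * sumAsc (suc n) (λ i → g (suc i) * h (n ∸ i)) + ((f′ ∗ g) ∗ h) n ∎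
  regroup : ∀ a b c s r → (a * b + 0) * c + (a * s + r) ≡ a * (b * c + s) + r
  regroup = solve-∀

-- The functional equation for d

Dseq : ℕ → ℕ → ℕ
Dseq m k = D k m

d-suc-D3 : ∀ k → d (suc k) ≡ 2 * D k 3 + 2 * d k
d-suc-D3 k = trans (D-suc k 2 (s≤s z≤n)) (regroup (D k 3) (d k))
  where
  regroup : ∀ x y → 2 * x + y + (y + 0) ≡ 2 * x + 2 * y
  regroup = solve-∀

d∗Dseq : ∀ k m → (d ∗ Dseq m) k ≡ D k m + 2 * shift (Dseq 3 ∗ Dseq m) k + 2 * shift (d ∗ Dseq m) k
d∗Dseq zero m = refl
d∗Dseq (suc k) m = begin
  d 0 * D (suc k) m + ((d ∘ suc) ∗ Dseq m) k
    ≡⟨ cong (_+_ (d 0 * D (suc k) m)) (begin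
         ((d ∘ suc) ∗ Dseq m) k
           ≡⟨ ∗-congˡ k (Dseq m) (λ i _ → d-suc-D3 i) ⟩
         ((λ i → 2 * D i 3 + 2 * d i) ∗ Dseq m) k
           ≡⟨ ∗-distribʳ-+ k (λ i → 2 * D i 3) (λ i → 2 * d i) (Dseq m) ⟩
         ((λ i → 2 * D i 3) ∗ Dseq m) k + ((λ i → 2 * d i) ∗ Dseq m) k
           ≡⟨ cong₂ _+_ (∗-scaleˡ k 2 (Dseq 3) (Dseq m)) (∗-scaleˡ k 2 d (Dseq m)) ⟩
         2 * (Dseq 3 ∗ Dseq m) k + 2 * (d ∗ Dseq m) k ∎) ⟩
  1 * D (suc k) m + (2 * (Dseq 3 ∗ Dseq m) k + 2 * (d ∗ Dseq m) k)
    ≡⟨ regroup (D (suc k) m) ((Dseq 3 ∗ Dseq m) k) ((d ∗ Dseq m) k) ⟩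
  D (suc k) m + 2 * (Dseq 3 ∗ Dseq m) k + 2 * (d ∗ Dseq m) k ∎
  where
  regroup : ∀ x y z → 1 * x + (2 * y + 2 * z) ≡ x + 2 * y + 2 * z
  regroup = solve-∀

LabelStep : ℕ → Set
LabelStep k = ∀ m → 2 ≤ m → D k (suc m) ≡ D k m + shift (d ∗ Dseq m) k

-- d ∗ (D(m+1) − D m) = x (d ∗ d) ∗ D m = (D 3 − d) ∗ D m by the induction hypothesis at m and at 2.
shift-d∗Dseq-suc : ∀ k m → 2 ≤ m → (∀ j → j < k → LabelStep j) →
                   shift (d ∗ Dseq (suc m)) k ≡ shift (Dseq 3 ∗ Dseq m) k
shift-d∗Dseq-suc zero m 2≤m ih = refl
shift-d∗Dseq-suc (suc k) m 2≤m ih = begin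
  (d ∗ Dseq (suc m)) k
    ≡⟨ ∗-congʳ k d (λ j j≤k → ih j (s≤s j≤k) m 2≤m) ⟩
  (d ∗ (λ j → D j m + shift (d ∗ Dseq m) j)) k
    ≡⟨ ∗-distribˡ-+ k d (Dseq m) (shift (d ∗ Dseq m)) ⟩
  (d ∗ Dseq m) k + (d ∗ shift (d ∗ Dseq m)) k
    ≡⟨ cong (_+_ ((d ∗ Dseq m) k)) reassociate ⟩
  (d ∗ Dseq m) k + (shift (d ∗ d) ∗ Dseq m) k
    ≡⟨ ∗-distribʳ-+ k d (shift (d ∗ d)) (Dseq m) ⟨
  ((λ i → d i + shift (d ∗ d) i) ∗ Dseq m) k
    ≡⟨ ∗-congˡ k (Dseq m) (λ i i≤k → sym (ih i (s≤s i≤k) 2 ≤-refl)) ⟩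
  (Dseq 3 ∗ Dseq m) k ∎
  where
  reassociate : (d ∗ shift (d ∗ Dseq m)) k ≡ (shift (d ∗ d) ∗ Dseq m) k
  reassociate = begin
    (d ∗ shift (d ∗ Dseq m)) k   ≡⟨ ∗-shift k d (d ∗ Dseq m) ⟩
    shift (d ∗ (d ∗ Dseq m)) k   ≡⟨ shift-cong k (λ j → sym (∗-assoc j d d (Dseq m))) ⟩
    shift ((d ∗ d) ∗ Dseq m) k   ≡⟨ shift-∗ k (d ∗ d) (Dseq m) ⟨
    (shift (d ∗ d) ∗ Dseq m) k   ∎
    where
    shift-cong : ∀ n {f g : ℕ → ℕ} → (∀ j → f j ≡ g j) → shift f n ≡ shift g n
    shift-cong zero _ = refl
    shift-cong (suc n) f≗g = f≗g n

labelStep : ∀ k → (∀ j → j < k → LabelStep j) → LabelStep k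
labelStep zero ih m 2≤m = refl
labelStep (suc k) ih m 2≤m = begin
  D (suc k) (suc m)
    ≡⟨ D-suc k (suc m) (s≤s z≤n) ⟩
  2 * D k (suc (suc m)) + D k (suc m) + D≥2-sum k (suc m)
    ≡⟨ cong₂ (λ u v → 2 * u + D k (suc m) + v) (IH (suc m) (≤-trans 2≤m (n≤1+n m)))
                                               (D≥2-sum-suc k m 1≤m) ⟩
  2 * (D k (suc m) + X) + D k (suc m) + (D k (suc m) + D≥2-sum k m)
    ≡⟨ cong₂ (λ u w → 2 * (u + w) + u + (u + D≥2-sum k m)) (IH m 2≤m) X≡Z ⟩
  2 * ((D k m + Y) + Z) + (D k m + Y) + ((D k m + Y) + D≥2-sum k m)
    ≡⟨ regroup (D k m) Y Z (D≥2-sum k m) ⟩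
  (2 * (D k m + Y) + D k m + D≥2-sum k m) + (D k m + 2 * Z + 2 * Y)
    ≡⟨ cong₂ _+_ (sym (trans (D-suc k m 1≤m) (cong (λ u → 2 * u + D k m + D≥2-sum k m) (IH m 2≤m))))
                 (sym (d∗Dseq k m)) ⟩
  D (suc k) m + (d ∗ Dseq m) k ∎
  where
  IH : LabelStep k
  IH = ih k ≤-refl
  1≤m : 1 ≤ m
  1≤m = ≤-trans (s≤s z≤n) 2≤m
  X = shift (d ∗ Dseq (suc m)) k
  Y = shift (d ∗ Dseq m) k
  Z = shift (Dseq 3 ∗ Dseq m) k
  X≡Z : X ≡ Z
  X≡Z = shift-d∗Dseq-suc k m 2≤m (λ j j<k → ih j (m<n⇒m<1+n j<k))
  regroup : ∀ a y z s → 2 * (a + y + z) + (a + y) + ((a + y) + s) ≡ (2 * (a + y) + a + s) + (a + 2 * z + 2 * y)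
  regroup = solve-∀

D-label-suc : ∀ k → LabelStep k
D-label-suc = <-rec LabelStep (λ k ih → labelStep k (λ j j<k → ih j<k))

d-suc : ∀ k → d (suc k) ≡ 4 * d k + 2 * shift (d ∗ d) k
d-suc k = trans (d-suc-D3 k) (trans (cong (λ u → 2 * u + 2 * d k) (D-label-suc k 2 ≤-refl))
  (regroup (d k) (shift (d ∗ d) k)))
  where
  regroup : ∀ x y → 2 * (x + y) + 2 * x ≡ 4 * x + 2 * y
  regroup = solve-∀

t : ℕ → ℕ
t zero = 0
t (suc zero) = 1
t (suc (suc k)) = d k

-- The coefficients of 2T² = T − x + x² in degrees ≥ 3, for T = x + x² d.
t∗t : ∀ k → 2 * (t ∗ t) (3 + k) ≡ t (3 + k)
t∗t k = begin
  2 * (0 * t (3 + k) + (1 * d k + (d ∗ t) (suc k)))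
    ≡⟨ cong (λ z → 2 * (0 * t (3 + k) + (1 * d k + z))) d∗t ⟩
  2 * (0 * t (3 + k) + (1 * d k + (d k + shift (d ∗ d) k)))
    ≡⟨ regroup (t (3 + k)) (d k) (shift (d ∗ d) k) ⟩
  4 * d k + 2 * shift (d ∗ d) k
    ≡⟨ d-suc k ⟨
  d (suc k) ∎
  where
  regroup : ∀ z x y → 2 * (0 * z + (1 * x + (x + y))) ≡ 4 * x + 2 * y
  regroup = solve-∀
  u : ℕ → ℕ
  u = t ∘ suc
  d∗t : (d ∗ t) (suc k) ≡ d k + shift (d ∗ d) k
  d∗t = begin
    (d ∗ t) (suc k)                            ≡⟨ ∗-congʳ (suc k) d t≡shift-u ⟩
    (d ∗ shift u) (suc k)                      ≡⟨ ∗-shift (suc k) d u ⟩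
    (d ∗ u) k                                  ≡⟨ ∗-congʳ k d u≡δ+shift-d ⟩
    (d ∗ (λ j → δ j + shift d j)) k            ≡⟨ ∗-distribˡ-+ k d δ (shift d) ⟩
    (d ∗ δ) k + (d ∗ shift d) k                ≡⟨ cong₂ _+_ (∗-δ k d) (∗-shift k d d) ⟩
    d k + shift (d ∗ d) k                      ∎
    where
    t≡shift-u : ∀ i → i ≤ suc k → t i ≡ shift u i
    t≡shift-u zero _ = refl
    t≡shift-u (suc i) _ = refl
    u≡δ+shift-d : ∀ j → j ≤ k → u j ≡ δ j + shift d j
    u≡δ+shift-d zero _ = refl
    u≡δ+shift-d (suc j) _ = refl

sumℤ : ℕ → (ℕ → ℤ) → ℤ
sumℤ zero g = + 0
sumℤ (suc n) g = g 0 ℤ.+ sumℤ n (g ∘ suc)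

sumℤ-cong : ∀ n {g h : ℕ → ℤ} → (∀ i → g i ≡ h i) → sumℤ n g ≡ sumℤ n h
sumℤ-cong zero g≗h = refl
sumℤ-cong (suc n) g≗h = cong₂ ℤ._+_ (g≗h 0) (sumℤ-cong n (g≗h ∘ suc))

sumℤ-zero : ∀ n → sumℤ n (λ _ → + 0) ≡ + 0
sumℤ-zero zero = refl
sumℤ-zero (suc n) = trans (+-identityˡ (sumℤ n (λ _ → + 0))) (sumℤ-zero n)

sumℤ-cast : ∀ n (A B : ℕ → ℕ) → sumℤ n (λ i → + A i ℤ.- + B i) ≡ + sumAsc n A ℤ.- + sumAsc n B
sumℤ-cast zero A B = refl
sumℤ-cast (suc n) A B = begin
  (+ A 0 ℤ.- + B 0) ℤ.+ sumℤ n (λ i → + A (suc i) ℤ.- + B (suc i))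
    ≡⟨ cong (ℤ._+_ (+ A 0 ℤ.- + B 0)) (sumℤ-cast n (A ∘ suc) (B ∘ suc)) ⟩
  (+ A 0 ℤ.- + B 0) ℤ.+ (+ sumAsc n (A ∘ suc) ℤ.- + sumAsc n (B ∘ suc))
    ≡⟨ regroup (+ A 0) (+ B 0) (+ sumAsc n (A ∘ suc)) (+ sumAsc n (B ∘ suc)) ⟩
  (+ A 0 ℤ.+ + sumAsc n (A ∘ suc)) ℤ.- (+ B 0 ℤ.+ + sumAsc n (B ∘ suc))
    ≡⟨ cong₂ ℤ._-_ (pos-+ (A 0) _) (pos-+ (B 0) _) ⟨
  + sumAsc (suc n) A ℤ.- + sumAsc (suc n) B ∎
  where
  regroup : ∀ a b c e → (a ℤ.- b) ℤ.+ (c ℤ.- e) ≡ (a ℤ.+ c) ℤ.- (b ℤ.+ e)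
  regroup = solveℤ-∀

⋆-sumℤ : ∀ (f g : FPS) n → (f ⋆ g) n ≡ sumℤ (suc n) (λ i → f i ℤ.* g (n ∸ i))
⋆-sumℤ f g n = foldr-applyUpTo (suc n) id
  where
  foldr-applyUpTo : ∀ m (h : ℕ → ℕ) →
    foldr ℤ._+_ (+ 0) (map (λ i → f i ℤ.* g (n ∸ i)) (applyUpTo h m))
    ≡ sumℤ m (λ i → f (h i) ℤ.* g (n ∸ h i))
  foldr-applyUpTo zero h = refl
  foldr-applyUpTo (suc m) h = cong (ℤ._+_ (f (h 0) ℤ.* g (n ∸ h 0))) (foldr-applyUpTo m (h ∘ suc))

R : FPS
R n = + δ n ℤ.- + (4 * t n)

-- Expanding (p − 4b)(c − 4e) with all products cast from ℕ, so that the sum over i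
-- becomes a difference of two convolutions of naturals.
R-product : ∀ p b c e → (+ p ℤ.- + (4 * b)) ℤ.* (+ c ℤ.- + (4 * e))
                        ≡ + (p * c + 16 * (b * e)) ℤ.- + (4 * (p * e + b * c))
R-product p b c e = begin
  (+ p ℤ.- + (4 * b)) ℤ.* (+ c ℤ.- + (4 * e))
    ≡⟨ cong₂ (λ x y → (+ p ℤ.- x) ℤ.* (+ c ℤ.- y)) (pos-* 4 b) (pos-* 4 e) ⟩
  (+ p ℤ.- + 4 ℤ.* + b) ℤ.* (+ c ℤ.- + 4 ℤ.* + e)
    ≡⟨ expand (+ p) (+ b) (+ c) (+ e) ⟩
  (+ p ℤ.* + c ℤ.+ + 16 ℤ.* (+ b ℤ.* + e)) ℤ.- + 4 ℤ.* (+ p ℤ.* + e ℤ.+ + b ℤ.* + c)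
    ≡⟨ cong₂ ℤ._-_ positive negative ⟨
  + (p * c + 16 * (b * e)) ℤ.- + (4 * (p * e + b * c)) ∎
  where
  expand : ∀ x y z w → (x ℤ.- + 4 ℤ.* y) ℤ.* (z ℤ.- + 4 ℤ.* w)
                       ≡ (x ℤ.* z ℤ.+ + 16 ℤ.* (y ℤ.* w)) ℤ.- + 4 ℤ.* (x ℤ.* w ℤ.+ y ℤ.* z)
  expand = solveℤ-∀
  positive : + (p * c + 16 * (b * e)) ≡ + p ℤ.* + c ℤ.+ + 16 ℤ.* (+ b ℤ.* + e)
  positive = trans (pos-+ (p * c) (16 * (b * e)))
                   (cong₂ ℤ._+_ (pos-* p c) (trans (pos-* 16 (b * e)) (cong (+ 16 ℤ.*_) (pos-* b e))))
  negative : + (4 * (p * e + b * c)) ≡ + 4 ℤ.* (+ p ℤ.* + e ℤ.+ + b ℤ.* + c)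
  negative = trans (pos-* 4 (p * e + b * c))
                   (cong (+ 4 ℤ.*_) (trans (pos-+ (p * e) (b * c)) (cong₂ ℤ._+_ (pos-* p e) (pos-* b c))))

R⋆R : ∀ n → (R ⋆ R) n ≡ poly (+ 1 ∷ -[1+ 7 ] ∷ + 8 ∷ []) n
R⋆R zero = refl
R⋆R (suc zero) = refl
R⋆R (suc (suc zero)) = refl
R⋆R n@(suc (suc (suc k))) = begin
  (R ⋆ R) n
    ≡⟨ ⋆-sumℤ R R n ⟩
  sumℤ (suc n) (λ i → R i ℤ.* R (n ∸ i))
    ≡⟨ sumℤ-cong (suc n) (λ i → R-product (δ i) (t i) (δ (n ∸ i)) (t (n ∸ i))) ⟩
  sumℤ (suc n) (λ i → + A i ℤ.- + B i)
    ≡⟨ sumℤ-cast (suc n) A B ⟩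
  + sumAsc (suc n) A ℤ.- + sumAsc (suc n) B
    ≡⟨ cong₂ (λ x y → + x ℤ.- + y) ΣA ΣB ⟩
  + (8 * t n) ℤ.- + (8 * t n)
    ≡⟨ +-inverseʳ (+ (8 * t n)) ⟩
  + 0 ∎
  where
  A B : ℕ → ℕ
  A i = δ i * δ (n ∸ i) + 16 * (t i * t (n ∸ i))
  B i = 4 * (δ i * t (n ∸ i) + t i * δ (n ∸ i))
  ΣA : sumAsc (suc n) A ≡ 8 * t n
  ΣA = begin
    sumAsc (suc n) A
      ≡⟨ sumAsc-+ (suc n) (λ i → δ i * δ (n ∸ i)) (λ i → 16 * (t i * t (n ∸ i))) ⟩
    (δ ∗ δ) n + sumAsc (suc n) (λ i → 16 * (t i * t (n ∸ i)))
      ≡⟨ cong₂ _+_ (δ-∗ n δ) (sumAsc-* (suc n) 16 (λ i → t i * t (n ∸ i))) ⟩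
    16 * (t ∗ t) n
      ≡⟨ *-assoc 8 2 ((t ∗ t) n) ⟩
    8 * (2 * (t ∗ t) n)
      ≡⟨ cong (8 *_) (t∗t k) ⟩
    8 * t n ∎
  ΣB : sumAsc (suc n) B ≡ 8 * t n
  ΣB = begin
    sumAsc (suc n) B
      ≡⟨ sumAsc-* (suc n) 4 (λ i → δ i * t (n ∸ i) + t i * δ (n ∸ i)) ⟩
    4 * sumAsc (suc n) (λ i → δ i * t (n ∸ i) + t i * δ (n ∸ i))
      ≡⟨ cong (4 *_) (sumAsc-+ (suc n) (λ i → δ i * t (n ∸ i)) (λ i → t i * δ (n ∸ i))) ⟩
    4 * ((δ ∗ t) n + (t ∗ δ) n)
      ≡⟨ cong (4 *_) (cong₂ _+_ (δ-∗ n t) (∗-δ n t)) ⟩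
    4 * (t n + t n)
      ≡⟨ double (t n) ⟩
    8 * t n ∎
    where
    double : ∀ x → 4 * (x + x) ≡ 8 * x
    double = solve-∀

G3gf-suc-suc : ∀ k → G3gf (suc (suc k)) ≡ G3gf (suc k) ℤ.+ + d k
G3gf-suc-suc k = begin
  + countG3 (suc (suc k))
    ≡⟨ cong +_ (countG3≡descendants (suc (suc k))) ⟩
  + descendants (suc (suc k)) 0 0
    ≡⟨ cong +_ (descendants-root k) ⟩
  + (descendants (suc k) 0 0 + d k)
    ≡⟨ pos-+ (descendants (suc k) 0 0) (d k) ⟩
  + descendants (suc k) 0 0 ℤ.+ + d k
    ≡⟨ cong (λ z → + z ℤ.+ + d k) (countG3≡descendants (suc k)) ⟨
  + countG3 (suc k) ℤ.+ + d k ∎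

G3gf-equation : ∀ n → (poly (+ 4 ∷ -[1+ 3 ] ∷ []) ⋆ G3gf) n ≡ (poly (+ 5 ∷ -[1+ 3 ] ∷ []) ⊖ R) n
G3gf-equation zero = refl
G3gf-equation (suc zero) = refl
G3gf-equation (suc (suc k)) = begin
  (poly (+ 4 ∷ -[1+ 3 ] ∷ []) ⋆ G3gf) (suc (suc k))
    ≡⟨ ⋆-sumℤ (poly (+ 4 ∷ -[1+ 3 ] ∷ [])) G3gf (suc (suc k)) ⟩
  + 4 ℤ.* G3gf (suc (suc k)) ℤ.+ (-[1+ 3 ] ℤ.* G3gf (suc k) ℤ.+ sumℤ (suc k) (λ _ → + 0))
    ≡⟨ cong₂ (λ x y → + 4 ℤ.* x ℤ.+ (-[1+ 3 ] ℤ.* G3gf (suc k) ℤ.+ y))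
             (G3gf-suc-suc k) (sumℤ-zero (suc k)) ⟩
  + 4 ℤ.* (G3gf (suc k) ℤ.+ + d k) ℤ.+ (-[1+ 3 ] ℤ.* G3gf (suc k) ℤ.+ + 0)
    ≡⟨ cancel (G3gf (suc k)) (+ d k) ⟩
  + 0 ℤ.- (+ 0 ℤ.- + 4 ℤ.* + d k)
    ≡⟨ cong (λ z → + 0 ℤ.- (+ 0 ℤ.- z)) (pos-* 4 (d k)) ⟨
  (poly (+ 5 ∷ -[1+ 3 ] ∷ []) ⊖ R) (suc (suc k)) ∎
  where
  cancel : ∀ a x → + 4 ℤ.* (a ℤ.+ x) ℤ.+ (-[1+ 3 ] ℤ.* a ℤ.+ + 0)
                      ≡ + 0 ℤ.- (+ 0 ℤ.- + 4 ℤ.* x)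
  cancel = solveℤ-∀

mainTheorem7 : Σ FPS (λ R →
                   (R 0 ≡ + 1)
                   × (∀ n → (R ⋆ R) n ≡ poly (+ 1 ∷ -[1+ 7 ] ∷ + 8 ∷ []) n)
                   × (∀ n → (poly (+ 4 ∷ -[1+ 3 ] ∷ []) ⋆ G3gf) n
                            ≡ (poly (+ 5 ∷ -[1+ 3 ] ∷ []) ⊖ R) n))
mainTheorem7 = R , refl , R⋆R , G3gf-equation
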